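{- Let $G=(G_t)_{t\geqslant 0}$, $G_t=(V_t,E_t)$, be a dynamic graph generated by D3G3 (defined in the context), and write $n_t=|V_t|$. If for all $t>0$ we have $n_t>0$ and $\mathcal{N}^V_t>0$, then $G$ is sustainable.
   Context: Let $\mathbb{T}=[0,1)^2$ be the unit torus (opposite sides identified) with its toroidal Euclidean distance $\mathrm{dist}$. A D3G3 instance is given by a threshold $d\in\,]0,\frac{\sqrt2}{2}[$, two sets $S_S,S_C$ of non-negative integers, and a seed graph $G_0=(V_0,E_0)\neq(\emptyset,\emptyset)$ whose vertices are points of $\mathbb{T}$. For every $t$, $G_t=(V_t,E_t)$ is the geometric graph with $E_t=\{\{u,v\}: u\neq v\in V_t,\ \mathrm{dist}(u,v)\leqslant d\}$. The graph $G_{t+1}$ is obtained from $G_t$ by applying simultaneously to every $v\in V_t$ the two rules: (conservation) $v\in V_{t+1}$ iff $\deg_{G_t}(v)\in S_S$; (creation) if $\deg_{G_t}(v)\in S_C$, a new vertex is added to $V_{t+1}$ at a position chosen uniformly at random on $\mathbb{T}$, independently of everything else. New vertices are fresh (distinct from every vertex that has ever appeared), and vertices never change position. The vertex nervousness at time $t$ is $\mathcal{N}^V_t=\frac{|V_{t+1}\triangle V_t|}{|V_{t+1}\cup V_t|}$, where $A\triangle B=(A\cup B)\setminus(A\cap B)$. A dynamic graph is sustainable if neither of the following holds: (1) there is $T\in\mathbb{N}$ with $G_t=(\emptyset,\emptyset)$ for all $t\geqslant T$; (2) there are $T\in\mathbb{N}$ and $k\in\mathbb{N}^*$ with $G_t=G_{t+k}$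 for all $t\geqslant T$. -}

module Defs where

open import Level using (0ℓ)
open import Data.Nat as ℕ using (ℕ; zero; suc)
open import Data.Nat.Properties using () renaming (_≟_ to _≟ℕ_)
open import Data.Integer using (ℤ; +_; -[1+_])
open import Data.Rational using (ℚ; _/_) renaming (0ℚ to 0ℚ)
open import Data.List using (List; []; length; filter; _++_; map)
open import Data.List.Membership.Propositional using (_∈_; _∉_)
open import Data.List.Membership.DecPropositional _≟ℕ_ using (_∉?_)
open import Data.List.Relation.Unary.Unique.Propositional using (Unique)
open import Data.Product using (Σ; ∃; ∃-syntax; _×_; _,_)
open import Data.Sum using (_⊎_)
open import Data.Empty using (⊥)
open import Relation.Nullary using (¬_)
open import Relation.Binary.PropositionalEquality using (_≡_; _≢_)
open import Relation.Binary.Structures using (IsTotalOrder)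
open import Algebra.Structures using (IsCommutativeRing)
open import Function.Bundles using (_⇔_)

-- The real numbers, given axiomatically as a complete ordered field
-- (any two models are isomorphic, so this is "ℝ").

record CompleteOrderedField : Set₁ where
  infixl 6 _+_
  infixl 7 _*_
  infix  4 _≤_ _<_
  field
    Carrier : Set
    _+_ _*_ : Carrier → Carrier → Carrier
    -_      : Carrier → Carrier
    0# 1#   : Carrier
    _≤_     : Carrier → Carrier → Set
    isCommutativeRing : IsCommutativeRing _≡_ _+_ _*_ -_ 0# 1#
    0≢1     : 0# ≢ 1#
    inverse : ∀ x → x ≢ 0# → ∃[ y ] (x * y ≡ 1#)
    isTotalOrder : IsTotalOrder _≡_ _≤_
    +-mono-≤ : ∀ x y z → x ≤ y → x + z ≤ y + z
    *-nonneg : ∀ x y → 0# ≤ x → 0# ≤ y → 0# ≤ x * y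
    complete : (P : Carrier → Set) → ∃ P → (∃[ b ] (∀ x → P x → x ≤ b)) →
               ∃[ s ] ((∀ x → P x → x ≤ s) ×
                       (∀ b → (∀ x → P x → x ≤ b) → s ≤ b))

  _<_ : Carrier → Carrier → Set
  x < y = x ≤ y × x ≢ y

  _-_ : Carrier → Carrier → Carrier
  x - y = x + (- y)

  fromℕ : ℕ → Carrier
  fromℕ zero    = 0#
  fromℕ (suc n) = 1# + fromℕ n

  fromℤ : ℤ → Carrier
  fromℤ (+ n)     = fromℕ n
  fromℤ -[1+ n ]  = - (1# + fromℕ n)

module D3G3 (R : CompleteOrderedField) where
  open CompleteOrderedField R

  Point : Set
  Point = Carrier × Carrier

  InTorus : Point → Set
  InTorus (x , y) = (0# ≤ x × x < 1#) × (0# ≤ y × y < 1#)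

  -- dist(p,q) ≤ d on the torus, where dist(p,q) = min over k ∈ ℤ² of the
  -- Euclidean norm |p - q + k|; for d > 0 this is "some lift has squared
  -- Euclidean length ≤ d²".
  DistLe : Point → Point → Carrier → Set
  DistLe (x , y) (x' , y') d =
    ∃[ i ] ∃[ j ] (let a = x - x' + fromℤ i ; b = y - y' + fromℤ j
                   in a * a + b * b ≤ d * d)

  -- An admissible threshold: d ∈ ]0, √2/2[, i.e. 0 < d and d² < 1/2.
  ValidThreshold : Carrier → Set
  ValidThreshold d = 0# < d × d * d + d * d < 1#

  -- Vertices are labelled by natural numbers
  -- (labels only serve to tell vertices apart), pos gives their position,
  -- V t is the (duplicate-free) list of vertices of G_t.
  record Run (d : Carrier) (SS SC : ℕ → Set) : Set where
    field
      pos : ℕ → Point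
      V   : ℕ → List ℕ
      pos-torus : ∀ v → InTorus (pos v)
      V-unique  : ∀ t → Unique (V t)

    Edge : ℕ → ℕ → ℕ → Set
    Edge t u v = u ∈ V t × v ∈ V t × u ≢ v × DistLe (pos u) (pos v) d

    Deg : ℕ → ℕ → ℕ → Set
    Deg t v k = ∃[ L ] (Unique L × (∀ u → u ∈ L ⇔ Edge t v u) × length L ≡ k)

    Conserved : ℕ → ℕ → Set
    Conserved t v = ∃[ k ] (Deg t v k × SS k)

    Creates : ℕ → ℕ → Set
    Creates t v = ∃[ k ] (Deg t v k × SC k)

    field
      seed-nonempty : V 0 ≢ []
      seed-points   : ∀ u v → u ∈ V 0 → v ∈ V 0 → pos u ≡ pos v → u ≡ v
      conservation : ∀ t v → v ∈ V t → (v ∈ V (suc t) ⇔ Conserved t v)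
      child        : ℕ → ℕ → ℕ
      child-in     : ∀ t v → v ∈ V t → Creates t v → child t v ∈ V (suc t)
      child-fresh  : ∀ t v → v ∈ V t → Creates t v →
                     ∀ s → s ℕ.≤ t → child t v ∉ V s
      child-inj    : ∀ t u v → u ∈ V t → Creates t u → v ∈ V t → Creates t v →
                     child t u ≡ child t v → u ≡ v
      child-onto   : ∀ t w → w ∈ V (suc t) → w ∉ V t →
                     ∃[ v ] (v ∈ V t × Creates t v × child t v ≡ w)

    n : ℕ → ℕ
    n t = length (V t)

    symDiff : ℕ → List ℕ
    symDiff t = filter (_∉? V t) (V (suc t)) ++ filter (_∉? V (suc t)) (V t)

    union : ℕ → List ℕ
    union t = V t ++ filter (_∉? V t) (V (suc t))

    -- vertex nervousness 𝒩^V_t = |V_{t+1} △ V_t| / |V_{t+1} ∪ V_t|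
    -- (the value 0 is used by convention when the union is empty)
    nervousness : ℕ → ℚ
    nervousness t with length (union t)
    ... | zero  = 0ℚ
    ... | suc m = (+ length (symDiff t)) / suc m

    EmptyGraph : ℕ → Set
    EmptyGraph t = V t ≡ [] × (∀ u v → ¬ Edge t u v)

    SameGraph : ℕ → ℕ → Set
    SameGraph t s = (∀ v → v ∈ V t ⇔ v ∈ V s) ×
                    (∀ u v → Edge t u v ⇔ Edge s u v)

    Sustainable : Set
    Sustainable =
      ¬ (∃[ T ] (∀ t → T ℕ.≤ t → EmptyGraph t)) ×
      ¬ (∃[ T ] ∃[ k ] (1 ℕ.≤ k × (∀ t → T ℕ.≤ t → SameGraph t (t ℕ.+ k))))

-- Suppose the run becomes periodic with period k from time T on. A vertex born at
-- time s + 1 ≥ T + 1 reappears as a newborn at time s + 1 + k; newborns are fresh,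
-- yet it already existed at time s + 1, so nothing is born after time T. Hence
-- V_{t+k} ⊆ V_{t+1} ⊆ V_t = V_{t+k}, so V_{t+1} = V_t and the nervousness vanishes.
-- Eventual emptiness is excluded directly by n_t > 0.
module Submission where

open import Defs
open import Data.Nat using (ℕ; zero; suc; _+_; _≤_; _<_; s≤s; z≤n)
open import Data.Nat.Properties using (≤-trans; n≤1+n; m≤m+n; +-suc; +-identityʳ; <-irrefl)
  renaming (_≟_ to _≟ℕ_)
open import Data.Rational using (0ℚ) renaming (_<_ to _<ℚ_)
import Data.Rational.Properties as ℚ
open import Data.List using (List; []; _∷_; length; filter)
open import Data.List.Membership.Propositional using (_∈_; _∉_)
open import Data.List.Membership.DecPropositional _≟ℕ_ using (_∉?_; _∈?_)
open import Data.List.Membership.Propositional.Properties using (∈-++⁻; ∈-filter⁻)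
open import Data.List.Relation.Binary.Subset.Propositional using (_⊆_)
open import Data.List.Relation.Unary.Any using (here)
open import Data.Product using (_×_; _,_; proj₁; proj₂; ∃-syntax)
open import Data.Sum using (inj₁; inj₂)
open import Data.Empty using (⊥-elim)
open import Relation.Nullary using (¬_; yes; no)
open import Relation.Binary.PropositionalEquality using (_≡_; refl; sym; subst)
open import Function.Base using (_∘_)
open import Function.Bundles using (Equivalence)

≡[]-if-no-members : {A : Set} {xs : List A} → (∀ x → x ∉ xs) → xs ≡ []
≡[]-if-no-members {xs = []}    _      = refl
≡[]-if-no-members {xs = x ∷ _} absent = ⊥-elim (absent x (here refl))

module _ {R : CompleteOrderedField} {d : CompleteOrderedField.Carrier R}
         {SS SC : ℕ → Set} (G : D3G3.Run R d SS SC) where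
  open D3G3.Run G

  nervousness-of-empty-symDiff : ∀ t → symDiff t ≡ [] → nervousness t ≡ 0ℚ
  nervousness-of-empty-symDiff t eq with length (union t)
  ... | zero  = refl
  ... | suc m rewrite eq = ℚ.0/n≡0 (suc m)

  V-≡ : ∀ {t s} → t ≡ s → V t ⊆ V s
  V-≡ refl w∈ = w∈

  V-⊆ : ∀ {t s} → SameGraph t s → V t ⊆ V s
  V-⊆ same = Equivalence.to (proj₁ same _)

  V-⊇ : ∀ {t s} → SameGraph t s → V s ⊆ V t
  V-⊇ same = Equivalence.from (proj₁ same _)

  PeriodicFrom : ℕ → ℕ → Set
  PeriodicFrom T k = ∀ t → T ≤ t → SameGraph t (t + k)

  module _ {T k : ℕ} (periodic : PeriodicFrom T (suc k)) where

    no-births : ∀ s → T ≤ s → V (suc s) ⊆ V s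
    no-births s T≤s {w} w∈V[s+1] with w ∈? V s
    ... | yes w∈V[s] = w∈V[s]
    ... | no  w∉V[s] with child-onto (s + suc k) w w∈V[s+1+k] w∉V[s+k]
      where
        w∈V[s+1+k] : w ∈ V (suc (s + suc k))
        w∈V[s+1+k] = V-⊆ (periodic (suc s) (≤-trans T≤s (n≤1+n s))) w∈V[s+1]
        w∉V[s+k] : w ∉ V (s + suc k)
        w∉V[s+k] = w∉V[s] ∘ V-⊇ (periodic s T≤s)
    ... | v , v∈V , creates , refl =
      ⊥-elim (child-fresh (s + suc k) v v∈V creates (suc s) s+1≤s+k w∈V[s+1])
      where
        s+1≤s+k : suc s ≤ s + suc k
        s+1≤s+k = subst (suc s ≤_) (sym (+-suc s k)) (s≤s (m≤m+n s k))

    V-antitone : ∀ {t} j → T ≤ t → V (t + j) ⊆ V t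
    V-antitone {t} zero    _   = V-≡ (+-identityʳ t)
    V-antitone {t} (suc j) T≤t w∈V[t+j+1] =
      V-antitone j T≤t (no-births (t + j) (≤-trans T≤t (m≤m+n t j))
        (V-≡ (+-suc t j) w∈V[t+j+1]))

    no-deaths : ∀ t → T ≤ t → V t ⊆ V (suc t)
    no-deaths t T≤t w∈V[t] =
      V-antitone k (≤-trans T≤t (n≤1+n t))
        (V-≡ (+-suc t k) (V-⊆ (periodic t T≤t) w∈V[t]))

    symDiff-empty : ∀ t → T ≤ t → symDiff t ≡ []
    symDiff-empty t T≤t = ≡[]-if-no-members absent
      where
        absent : ∀ w → w ∉ symDiff t
        absent w w∈ with ∈-++⁻ (filter (_∉? V t) (V (suc t))) w∈
        ... | inj₁ born = let (w∈V[t+1] , w∉V[t]) = ∈-filter⁻ (_∉? V t) born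
                          in w∉V[t] (no-births t T≤t w∈V[t+1])
        ... | inj₂ dies = let (w∈V[t] , w∉V[t+1]) = ∈-filter⁻ (_∉? V (suc t)) dies
                          in w∉V[t+1] (no-deaths t T≤t w∈V[t])

  sustainable : (∀ t → 0 < t → 0 < n t × 0ℚ <ℚ nervousness t) → Sustainable
  sustainable alive = not-eventually-empty , not-eventually-periodic
    where
      not-eventually-empty : ¬ (∃[ T ] (∀ t → T ≤ t → EmptyGraph t))
      not-eventually-empty (T , empty) with proj₁ (alive (suc T) (s≤s z≤n))
      ... | 0<n rewrite proj₁ (empty (suc T) (n≤1+n T)) = <-irrefl refl 0<n

      not-eventually-periodic :
        ¬ (∃[ T ] ∃[ k ] (1 ≤ k × (∀ t → T ≤ t → SameGraph t (t + k))))
      not-eventually-periodic (T , suc k , _ , periodic) =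
        ℚ.<-irrefl (sym nervous≡0) (proj₂ (alive (suc T) (s≤s z≤n)))
        where
          nervous≡0 : nervousness (suc T) ≡ 0ℚ
          nervous≡0 = nervousness-of-empty-symDiff (suc T)
                        (symDiff-empty periodic (suc T) (n≤1+n T))

theorem1 : (R : CompleteOrderedField) → let open CompleteOrderedField R using (Carrier) in
    (d : Carrier) → D3G3.ValidThreshold R d → (SS SC : ℕ → Set) →
    (G : D3G3.Run R d SS SC) →
    (∀ t → 0 < t → 0 < D3G3.Run.n G t × 0ℚ <ℚ D3G3.Run.nervousness G t) →
    D3G3.Run.Sustainable G
theorem1 R d _ SS SC G = sustainable G
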